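{- Let $r<\Delta(G)$ be a positive even integer and set $u:=r/2$. Let $G$ be a graph whose edge set is partitioned into $(\le 2)$-regular subgraphs $R_0,\dots,R_{t-1}$, each having exactly $n$ edges, with orderings $\ell_0,\dots,\ell_{t-1}$ respectively, subscripts taken modulo $t$. Let $\epsilon$ be a non-zero element of $[\lceil n/2\rceil]$. If $ms_2(\ell_i,\ell_{i+u})\ge n-\epsilon$ for all $i\in[t-u]$, then $ms_r(G)\ge \frac{rn}{2}-\epsilon$. If $ms_2(\ell_i,\ell_{i+u})\ge n-\epsilon$ for all $i\in[t]$, then $cms_r(G)\ge \frac{rn}{2}-\epsilon$.
   Context: All graphs are simple; $\Delta(G)$ is the maximum degree. For an integer $N$, $[N]=\{0,\dots,N-1\}$. A graph is $(\le r)$-regular if every vertex has degree at most $r$. An ordering of a graph $H=(V,E)$ is a bijection $\ell:E\to[|E|]$; edges are consecutive (resp. cyclically consecutive) if their labels are consecutive integers (resp. modulo $|E|$). $ms_r(G)$ (resp. $cms_r(G)$) is the maximum over orderings $\ell$ of $G$ of the largest $s$ such that every $s$ consecutive (resp. cyclically consecutive) edges of $\ell$ form a $(\le r)$-regular subgraph. For edge-disjoint graphs $H,H'$ on the same vertex set with orderings $\ell,\ell'$, consider the list of edges of $H$ in the order given by $\ell$ followed by the edges of $H'$ in the order given by $\ell'$; $ms_r(\ell,\ell')$ is the largest integer $s$ such that every $s$ consecutive entries of this list that include at least one edge of $H$ and at least one edge of $H'$ form a $(\le r)$-regular graph. -}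

module Defs where

open import Data.Nat using (ℕ; zero; suc; _+_; _*_; _∸_; _≤_; _<_; _⊔_)
open import Data.Nat.DivMod using (_mod_)
open import Data.Fin using (Fin; toℕ; _≟_)
import Data.Fin as F
open import Data.Bool using (Bool; true; false)
open import Data.List using (List; []; _∷_; length; take; drop; _++_; map; foldr; allFin)
open import Data.List.Relation.Unary.All using (All)
open import Data.List.Relation.Unary.Unique.Propositional using (Unique)
open import Data.List.Relation.Binary.Permutation.Propositional using (_↭_)
open import Data.Product using (Σ; _×_; _,_; proj₁; proj₂; ∃)
open import Relation.Nullary.Decidable using (isYes)

-- An edge on vertex set Fin v, stored as an ordered pair (x , y) with x < y
-- (so an unordered pair {x,y} has exactly one representation).
Edge : ℕ → Set
Edge v = Fin v × Fin v

SimpleGraph : ∀ {v} → List (Edge v) → Set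
SimpleGraph E = All (λ e → proj₁ e F.< proj₂ e) E × Unique E

b2n : Bool → ℕ
b2n true = 1
b2n false = 0

deg : ∀ {v} → Fin v → List (Edge v) → ℕ
deg x [] = 0
deg x ((a , b) ∷ L) = b2n (isYes (a ≟ x)) + b2n (isYes (b ≟ x)) + deg x L

maxDeg : ∀ {v} → List (Edge v) → ℕ
maxDeg {v} E = foldr _⊔_ 0 (map (λ x → deg x E) (allFin v))

Regular : ∀ {v} → ℕ → List (Edge v) → Set
Regular {v} r L = (x : Fin v) → deg x L ≤ r

-- an ordering of the graph with edge list E = a list enumerating its edges
-- (position in the list = label)
IsOrdering : ∀ {v} → List (Edge v) → List (Edge v) → Set
IsOrdering E L = L ↭ E

ConsecGood : ∀ {v} → ℕ → List (Edge v) → ℕ → Set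
ConsecGood r L s = (i : ℕ) → i + s ≤ length L → Regular r (take s (drop i L))

CycConsecGood : ∀ {v} → ℕ → List (Edge v) → ℕ → Set
CycConsecGood r L s = (i : ℕ) → i < length L → Regular r (take s (drop i (L ++ L)))

MsAtLeast : ∀ {v} → ℕ → List (Edge v) → ℕ → Set
MsAtLeast {v} r E k = Σ (List (Edge v)) λ L → IsOrdering E L ×
  ∃ λ s → k ≤ s × s ≤ length E × ConsecGood r L s

CmsAtLeast : ∀ {v} → ℕ → List (Edge v) → ℕ → Set
CmsAtLeast {v} r E k = Σ (List (Edge v)) λ L → IsOrdering E L ×
  ∃ λ s → k ≤ s × s ≤ length E × CycConsecGood r L s

MixedGood : ∀ {v} → ℕ → List (Edge v) → List (Edge v) → ℕ → Set
MixedGood r L L' s = (i : ℕ) → i + s ≤ length L + length L' →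
  i < length L → length L < i + s → Regular r (take s (drop i (L ++ L')))

MsPairAtLeast : ∀ {v} → ℕ → List (Edge v) → List (Edge v) → ℕ → Set
MsPairAtLeast r L L' k = ∃ λ s → k ≤ s × s ≤ length L + length L' × MixedGood r L L' s

_⊕_ : ∀ {t} → Fin t → ℕ → Fin t
_⊕_ {suc t} i u = (toℕ i + u) mod (suc t)

-- Concatenating ℓ_0, …, ℓ_{t-1} (twice, for the cyclic case) orders G as a sequence of blocks of
-- n edges, each (≤ 2)-regular. A window of un − ε consecutive edges starting at offset a of block q
-- either lies inside the u blocks q, …, q+u−1 (when a ≤ ε), or consists of the last n − a edges of
-- block q, the u − 1 full blocks in between, and the first a − ε edges of block q+u. In the second
-- case the two partial pieces lie in one window of ℓ_q followed by ℓ_{q+u} of length ≥ n − ε that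
-- meets both, so together they add at most 2 to any degree; the full blocks add at most 2(u − 1).

module Submission where

open import Defs
open import Data.Nat using (ℕ; _*_; _∸_; _≤_; _<_; ⌈_/2⌉)
open import Data.Fin using (Fin; toℕ)
open import Data.List using (List; length; map; concat; allFin)
open import Data.List.Relation.Binary.Permutation.Propositional using (_↭_)
open import Data.Product using (_×_)
open import Relation.Binary.PropositionalEquality using (_≡_)

open import Data.Nat using (zero; suc; _+_; z≤n; s≤s; NonZero)
open import Data.Nat.Properties hiding (_≟_)
open import Data.Nat.DivMod using (_mod_; _%_; _/_; m%n<n; m≡m%n+[m/n]*n; m<n⇒m%n≡m; %-distribˡ-+; m%n%n≡m%n; [m+n]%n≡m%n)
open import Data.Nat.ListAction using (sum)
open import Data.Nat.ListAction.Properties using (sum-↭)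
open import Data.Nat.Tactic.RingSolver using (solve-∀)
open import Data.Fin using (_≟_)
import Data.Fin as Fin
open import Data.Fin.Properties using (toℕ-fromℕ<; toℕ-injective; toℕ<n)
open import Data.List using ([]; _∷_; _++_; take; drop; tabulate; applyUpTo)
open import Data.List.Properties
  using (take++drop≡id; drop-drop; drop-[]; take-[]; length-drop; length-++; length-map; length-tabulate;
         map-tabulate; concat-++; foldr-preservesᵇ)
open import Data.List.Relation.Binary.Permutation.Propositional using (↭-sym)
open import Data.List.Relation.Binary.Permutation.Propositional.Properties using (map⁺; ↭-length)
open import Data.List.Relation.Unary.All using (All; []; _∷_) renaming (map to All-map)
open import Data.List.Relation.Unary.All.Properties using (tabulate⁺) renaming (map⁺ to All-map⁺)
open import Data.Product using (∃; _,_)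
open import Relation.Binary.PropositionalEquality using (refl; sym; trans; cong; cong₂; subst; module ≡-Reasoning)
open import Relation.Nullary using (yes; no)
open import Relation.Nullary.Decidable using (isYes)

private variable
  A : Set
  v : ℕ

take-+ : (m k : ℕ) (xs : List A) → take (m + k) xs ≡ take m xs ++ take k (drop m xs)
take-+ zero    k xs       = refl
take-+ (suc m) zero    [] = refl
take-+ (suc m) (suc k) [] = refl
take-+ (suc m) k (x ∷ xs) = cong (x ∷_) (take-+ m k xs)

take-++ˡ : (m : ℕ) (xs ys : List A) → m ≤ length xs → take m (xs ++ ys) ≡ take m xs
take-++ˡ zero    xs       ys _         = refl
take-++ˡ (suc m) (x ∷ xs) ys (s≤s m≤) = cong (x ∷_) (take-++ˡ m xs ys m≤)

drop-++ˡ : (m : ℕ) (xs ys : List A) → m ≤ length xs → drop m (xs ++ ys) ≡ drop m xs ++ ys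
drop-++ˡ zero    xs       ys _         = refl
drop-++ˡ (suc m) (x ∷ xs) ys (s≤s m≤) = drop-++ˡ m xs ys m≤

take-length-++ : (xs ys : List A) → take (length xs) (xs ++ ys) ≡ xs
take-length-++ []       ys = refl
take-length-++ (x ∷ xs) ys = cong (x ∷_) (take-length-++ xs ys)

drop-length-++ : (xs ys : List A) → drop (length xs) (xs ++ ys) ≡ ys
drop-length-++ []       ys = refl
drop-length-++ (x ∷ xs) ys = drop-length-++ xs ys

window : ℕ → ℕ → List A → List A
window i s xs = take s (drop i xs)

window-+ : (i s s' : ℕ) (xs : List A) →
  window i (s + s') xs ≡ window i s xs ++ window (i + s) s' xs
window-+ i s s' xs =
  trans (take-+ s s' (drop i xs)) (cong (λ ys → window i s xs ++ take s' ys) (drop-drop i s xs))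

window-suffix : (a : ℕ) (xs ys : List A) → a ≤ length xs →
  window a (length xs ∸ a) (xs ++ ys) ≡ drop a xs
window-suffix a xs ys a≤ = begin
  take (length xs ∸ a) (drop a (xs ++ ys))    ≡⟨ cong (take (length xs ∸ a)) (drop-++ˡ a xs ys a≤) ⟩
  take (length xs ∸ a) (drop a xs ++ ys)      ≡⟨ cong (λ k → take k (drop a xs ++ ys)) (sym (length-drop a xs)) ⟩
  take (length (drop a xs)) (drop a xs ++ ys) ≡⟨ take-length-++ (drop a xs) ys ⟩
  drop a xs                                   ∎
  where open ≡-Reasoning

window-prefix : (m : ℕ) (xs ys : List A) → window (length xs) m (xs ++ ys) ≡ take m ys
window-prefix m xs ys = cong (take m) (drop-length-++ xs ys)

incidence : Fin v → Edge v → ℕ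
incidence x (a , b) = b2n (isYes (a ≟ x)) + b2n (isYes (b ≟ x))

deg≡sum-incidence : (x : Fin v) (xs : List (Edge v)) → deg x xs ≡ sum (map (incidence x) xs)
deg≡sum-incidence x []       = refl
deg≡sum-incidence x (e ∷ xs) = cong (incidence x e +_) (deg≡sum-incidence x xs)

deg-↭ : (x : Fin v) {xs ys : List (Edge v)} → xs ↭ ys → deg x xs ≡ deg x ys
deg-↭ x {xs} {ys} xs↭ys = begin
  deg x xs                   ≡⟨ deg≡sum-incidence x xs ⟩
  sum (map (incidence x) xs) ≡⟨ sum-↭ (map⁺ (incidence x) xs↭ys) ⟩
  sum (map (incidence x) ys) ≡⟨ deg≡sum-incidence x ys ⟨
  deg x ys                   ∎
  where open ≡-Reasoning

deg-++ : (x : Fin v) (xs ys : List (Edge v)) → deg x (xs ++ ys) ≡ deg x xs + deg x ys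
deg-++ x []       ys = refl
deg-++ x (e ∷ xs) ys =
  trans (cong (incidence x e +_) (deg-++ x xs ys)) (sym (+-assoc (incidence x e) (deg x xs) (deg x ys)))

deg-take≤deg : (x : Fin v) (m : ℕ) (xs : List (Edge v)) → deg x (take m xs) ≤ deg x xs
deg-take≤deg x m xs = begin
  deg x (take m xs)                     ≤⟨ m≤m+n _ _ ⟩
  deg x (take m xs) + deg x (drop m xs) ≡⟨ deg-++ x (take m xs) (drop m xs) ⟨
  deg x (take m xs ++ drop m xs)        ≡⟨ cong (deg x) (take++drop≡id m xs) ⟩
  deg x xs                              ∎
  where open ≤-Reasoning

deg-window-+ : (x : Fin v) (i s s' : ℕ) (xs : List (Edge v)) →
  deg x (window i (s + s') xs) ≡ deg x (window i s xs) + deg x (window (i + s) s' xs)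
deg-window-+ x i s s' xs = trans (cong (deg x) (window-+ i s s' xs)) (deg-++ x (window i s xs) (window (i + s) s' xs))

deg-window-mono : (x : Fin v) {i j m s : ℕ} (xs : List (Edge v)) → i ≤ j → j + m ≤ i + s →
  deg x (window j m xs) ≤ deg x (window i s xs)
deg-window-mono x {i} {j} {m} {s} xs i≤j inside with m≤n⇒∃[o]m+o≡n i≤j
... | d , refl with m≤n⇒∃[o]m+o≡n (+-cancelˡ-≤ i (d + m) s (subst (_≤ i + s) (+-assoc i d m) inside))
... | e , refl = begin
  deg x (window (i + d) m xs)                                  ≤⟨ m≤n+m _ _ ⟩
  deg x (window i d xs) + deg x (window (i + d) m xs)          ≡⟨ deg-window-+ x i d m xs ⟨
  deg x (window i (d + m) xs)                                  ≤⟨ m≤m+n _ _ ⟩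
  deg x (window i (d + m) xs) + deg x (window (i + (d + m)) e xs) ≡⟨ deg-window-+ x i (d + m) e xs ⟨
  deg x (window i (d + m + e) xs)                              ∎
  where open ≤-Reasoning

deg-concat≤ : (x : Fin v) {c : ℕ} (xss : List (List (Edge v))) → All (λ xs → deg x xs ≤ c) xss →
  deg x (concat xss) ≤ c * length xss
deg-concat≤ x []         []           = z≤n
deg-concat≤ x {c} (xs ∷ xss) (xs≤c ∷ xss≤c) = begin
  deg x (xs ++ concat xss)           ≡⟨ deg-++ x xs (concat xss) ⟩
  deg x xs + deg x (concat xss)      ≤⟨ +-mono-≤ xs≤c (deg-concat≤ x xss xss≤c) ⟩
  c + c * length xss                 ≡⟨ *-suc c (length xss) ⟨
  c * suc (length xss)               ∎
  where open ≤-Reasoning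

maxDeg≤ : (E : List (Edge v)) {b : ℕ} → (∀ x → deg x E ≤ b) → maxDeg E ≤ b
maxDeg≤ E {b} deg≤b = foldr-preservesᵇ {P = _≤ b} ⊔-lub z≤n (All-map⁺ (tabulate⁺ deg≤b))

maxDeg-concat≤ : (E : List (Edge v)) {c : ℕ} (Hs : List (List (Edge v))) →
  E ↭ concat Hs → All (Regular c) Hs → maxDeg E ≤ c * length Hs
maxDeg-concat≤ E Hs E↭ Hs-regular = maxDeg≤ E λ x →
  ≤-trans (≤-reflexive (deg-↭ x E↭)) (deg-concat≤ x Hs (All-map (λ regular → regular x) Hs-regular))

blocks : (ℕ → List A) → ℕ → List A
blocks β K = concat (applyUpTo β K)

BlockLengths : ℕ → (ℕ → List A) → Set
BlockLengths n β = ∀ j → length (β j) ≡ n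

module _ {n : ℕ} where

  drop-first-block : (β : ℕ → List A) → length (β 0) ≡ n → (m K : ℕ) →
    drop (n + m) (blocks β (suc K)) ≡ drop m (blocks (λ i → β (suc i)) K)
  drop-first-block β refl m K =
    trans (sym (drop-drop (length (β 0)) m (blocks β (suc K))))
          (cong (drop m) (drop-length-++ (β 0) (blocks (λ i → β (suc i)) K)))

  drop-blocks-< : (β : ℕ → List A) → BlockLengths n β → ∀ {j K} → j < K →
    drop (j * n) (blocks β K) ≡ β j ++ drop (suc j * n) (blocks β K)
  drop-blocks-< β len {zero} {suc K} _ = sym (cong (β 0 ++_) (drop-first-block β (len 0) 0 K))
  drop-blocks-< β len {suc j} {suc K} (s≤s j<K) = begin
    drop (n + j * n) (blocks β (suc K))
      ≡⟨ drop-first-block β (len 0) (j * n) K ⟩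
    drop (j * n) (blocks (λ i → β (suc i)) K)
      ≡⟨ drop-blocks-< (λ i → β (suc i)) (λ i → len (suc i)) j<K ⟩
    β (suc j) ++ drop (suc j * n) (blocks (λ i → β (suc i)) K)
      ≡⟨ cong (β (suc j) ++_) (drop-first-block β (len 0) (suc j * n) K) ⟨
    β (suc j) ++ drop (suc (suc j) * n) (blocks β (suc K)) ∎
    where open ≡-Reasoning

  drop-blocks-≥ : (β : ℕ → List A) → BlockLengths n β → ∀ {j K} → K ≤ j →
    drop (j * n) (blocks β K) ≡ []
  drop-blocks-≥ β len {j}     {zero}  _         = drop-[] (j * n)
  drop-blocks-≥ β len {suc j} {suc K} (s≤s K≤j) =
    trans (drop-first-block β (len 0) (j * n) K) (drop-blocks-≥ (λ i → β (suc i)) (λ i → len (suc i)) K≤j)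

  length-blocks : (β : ℕ → List A) → BlockLengths n β → ∀ K → length (blocks β K) ≡ K * n
  length-blocks β len zero    = refl
  length-blocks β len (suc K) = begin
    length (β 0 ++ blocks (λ i → β (suc i)) K)
      ≡⟨ length-++ (β 0) ⟩
    length (β 0) + length (blocks (λ i → β (suc i)) K)
      ≡⟨ cong₂ _+_ (len 0) (length-blocks (λ i → β (suc i)) (λ i → len (suc i)) K) ⟩
    n + K * n ∎
    where open ≡-Reasoning

module _ {n : ℕ} (β : ℕ → List A) (len : BlockLengths n β) {K : ℕ} where

  window-blocks-head : ∀ {j m} → j < K → m ≤ n → window (j * n) m (blocks β K) ≡ take m (β j)
  window-blocks-head {j} {m} j<K m≤n =
    trans (cong (take m) (drop-blocks-< β len j<K))
          (take-++ˡ m (β j) _ (subst (m ≤_) (sym (len j)) m≤n))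

  window-blocks-tail : ∀ {j a} → j < K → a ≤ n →
    window (j * n + a) (n ∸ a) (blocks β K) ≡ drop a (β j)
  window-blocks-tail {j} {a} j<K a≤n = begin
    take (n ∸ a) (drop (j * n + a) (blocks β K))   ≡⟨ cong (take (n ∸ a)) (drop-drop (j * n) a (blocks β K)) ⟨
    window a (n ∸ a) (drop (j * n) (blocks β K))   ≡⟨ cong (window a (n ∸ a)) (drop-blocks-< β len j<K) ⟩
    window a (n ∸ a) (β j ++ rest)                 ≡⟨ cong (λ k → window a (k ∸ a) (β j ++ rest)) (len j) ⟨
    window a (length (β j) ∸ a) (β j ++ rest)      ≡⟨ window-suffix a (β j) rest (subst (a ≤_) (sym (len j)) a≤n) ⟩
    drop a (β j)                                   ∎
    where
    open ≡-Reasoning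
    rest = drop (suc j * n) (blocks β K)

  window-blocks-past : ∀ {j} m → K ≤ j → window (j * n) m (blocks β K) ≡ []
  window-blocks-past m K≤j = trans (cong (take m) (drop-blocks-≥ β len K≤j)) (take-[] m)

module _ {n c : ℕ} (β : ℕ → List (Edge v)) (len : BlockLengths n β) (K : ℕ)
         (x : Fin v) (deg-β≤c : ∀ j → deg x (β j) ≤ c) where

  deg-window-block : ∀ j → deg x (window (j * n) n (blocks β K)) ≤ c
  deg-window-block j with j <? K
  ... | yes j<K = begin
    deg x (window (j * n) n (blocks β K)) ≡⟨ cong (deg x) (window-blocks-head β len j<K ≤-refl) ⟩
    deg x (take n (β j))                  ≤⟨ deg-take≤deg x n (β j) ⟩
    deg x (β j)                           ≤⟨ deg-β≤c j ⟩
    c                                     ∎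
    where open ≤-Reasoning
  ... | no j≮K = subst (λ xs → deg x xs ≤ c) (sym (window-blocks-past β len n (≮⇒≥ j≮K))) z≤n

  deg-window-blocks : ∀ j k → deg x (window (j * n) (k * n) (blocks β K)) ≤ c * k
  deg-window-blocks j zero    = z≤n
  deg-window-blocks j (suc k) = begin
    deg x (window (j * n) (n + k * n) M)
      ≡⟨ deg-window-+ x (j * n) n (k * n) M ⟩
    deg x (window (j * n) n M) + deg x (window (j * n + n) (k * n) M)
      ≡⟨ cong (λ i → deg x (window (j * n) n M) + deg x (window i (k * n) M)) (+-comm (j * n) n) ⟩
    deg x (window (j * n) n M) + deg x (window (suc j * n) (k * n) M)
      ≤⟨ +-mono-≤ (deg-window-block j) (deg-window-blocks (suc j) k) ⟩
    c + c * k
      ≡⟨ *-suc c k ⟨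
    c * suc k ∎
    where
    open ≤-Reasoning
    M = blocks β K

crossing-window : ∀ {n ε a s} → n ∸ ε ≤ s → s ≤ n + n → ε < a → a < n →
  ∃ λ i → i ≤ a × n + (a ∸ ε) ≤ i + s × i + s ≤ n + n
crossing-window {n} {ε} {a} {s} n∸ε≤s s≤2n ε<a a<n with a + s ≤? n + n
... | yes fits = a , ≤-refl , reaches , fits
  where
  reaches : n + (a ∸ ε) ≤ a + s
  reaches = begin
    n + (a ∸ ε) ≡⟨ +-∸-assoc n (<⇒≤ ε<a) ⟨
    n + a ∸ ε   ≡⟨ +-∸-comm a (<⇒≤ (<-trans ε<a a<n)) ⟩
    n ∸ ε + a   ≤⟨ +-monoˡ-≤ a n∸ε≤s ⟩
    s + a       ≡⟨ +-comm s a ⟩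
    a + s       ∎
    where open ≤-Reasoning
... | no overflows = n + n ∸ s , start≤a , reaches , ≤-reflexive ends
  where
  ends : n + n ∸ s + s ≡ n + n
  ends = m∸n+n≡m s≤2n
  start≤a : n + n ∸ s ≤ a
  start≤a = m≤n+o⇒m∸n≤o (n + n) s (≤-trans (<⇒≤ (≰⇒> overflows)) (≤-reflexive (+-comm a s)))
  reaches : n + (a ∸ ε) ≤ n + n ∸ s + s
  reaches = subst (n + (a ∸ ε) ≤_) (sym ends) (+-monoʳ-≤ n (≤-trans (m∸n≤m a ε) (<⇒≤ a<n)))

deg-crossing≤ : (x : Fin v) (C C' : List (Edge v)) {n ε a : ℕ} → length C ≡ n → length C' ≡ n →
  MsPairAtLeast 2 C C' (n ∸ ε) → ε < a → a < n →
  deg x (drop a C) + deg x (take (a ∸ ε) C') ≤ 2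
deg-crossing≤ x C C' {ε = ε} {a} refl lenC' (s , n∸ε≤s , s≤ , mixed) ε<a a<n
  with crossing-window n∸ε≤s (subst (λ k → s ≤ length C + k) lenC' s≤) ε<a a<n
... | i , i≤a , reaches , fits = begin
  deg x (drop a C) + deg x (take b C')
    ≡⟨ cong₂ (λ ys zs → deg x ys + deg x zs) (window-suffix a C C' (<⇒≤ a<n)) (window-prefix b C C') ⟨
  deg x (window a (n ∸ a) D) + deg x (window n b D)
    ≡⟨ cong (λ k → deg x (window a (n ∸ a) D) + deg x (window k b D)) (m+[n∸m]≡n (<⇒≤ a<n)) ⟨
  deg x (window a (n ∸ a) D) + deg x (window (a + (n ∸ a)) b D)
    ≡⟨ deg-window-+ x a (n ∸ a) b D ⟨
  deg x (window a (n ∸ a + b) D)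
    ≤⟨ deg-window-mono x D i≤a covered ⟩
  deg x (window i s D)
    ≤⟨ mixed i (subst (λ k → i + s ≤ n + k) (sym lenC') fits) (≤-<-trans i≤a a<n) crosses x ⟩
  2 ∎
  where
  open ≤-Reasoning
  n = length C
  b = a ∸ ε
  D = C ++ C'
  covered : a + (n ∸ a + b) ≤ i + s
  covered = subst (_≤ i + s) (trans (cong (_+ b) (sym (m+[n∸m]≡n (<⇒≤ a<n)))) (+-assoc a (n ∸ a) b)) reaches
  crosses : n < i + s
  crosses = <-≤-trans (m<m+n n (m<n⇒0<n∸m ε<a)) reaches

q*n+a+[n∸a]≡[1+q]*n : ∀ q n {a} → a ≤ n → q * n + a + (n ∸ a) ≡ suc q * n
q*n+a+[n∸a]≡[1+q]*n q n {a} a≤n =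
  trans (+-assoc (q * n) a (n ∸ a)) (trans (cong (q * n +_) (m+[n∸m]≡n a≤n)) (+-comm (q * n) n))

[1+q]*n+u*n≡[q+1+u]*n : ∀ q n u → suc q * n + u * n ≡ (q + suc u) * n
[1+q]*n+u*n≡[q+1+u]*n q n u = trans (sym (*-distribʳ-+ n (suc q) u)) (cong (_* n) (sym (+-suc q u)))

[1+u]*n∸ε≡[n∸a]+[u*n+[a∸ε]] : ∀ u n {ε a} → ε ≤ a → a ≤ n →
  suc u * n ∸ ε ≡ n ∸ a + (u * n + (a ∸ ε))
[1+u]*n∸ε≡[n∸a]+[u*n+[a∸ε]] u n {ε} {a} ε≤a a≤n =
  trans (cong (_∸ ε) (sym pieces+ε)) (m+n∸n≡m (n ∸ a + (u * n + (a ∸ ε))) ε)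
  where
  rearrange : ∀ c m d e → c + (m + d) + e ≡ c + (d + e) + m
  rearrange = solve-∀
  pieces+ε : n ∸ a + (u * n + (a ∸ ε)) + ε ≡ suc u * n
  pieces+ε = begin
    n ∸ a + (u * n + (a ∸ ε)) + ε ≡⟨ rearrange (n ∸ a) (u * n) (a ∸ ε) ε ⟩
    n ∸ a + (a ∸ ε + ε) + u * n   ≡⟨ cong (λ k → n ∸ a + k + u * n) (m∸n+n≡m ε≤a) ⟩
    n ∸ a + a + u * n             ≡⟨ cong (_+ u * n) (m∸n+n≡m a≤n) ⟩
    n + u * n                     ∎
    where open ≡-Reasoning

module _ {n : ℕ} (β : ℕ → List (Edge v)) (len : BlockLengths n β) {K : ℕ}
         (x : Fin v) (deg-β≤2 : ∀ j → deg x (β j) ≤ 2) (u ε : ℕ) where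

  private
    M = blocks β K

  CrossingBound : ℕ → ℕ → Set
  CrossingBound q a =
    q + suc u < K → ε < a → deg x (drop a (β q)) + deg x (take (a ∸ ε) (β (q + suc u))) ≤ 2

  deg-window≤-early-start : ∀ q a → a ≤ ε → a < n →
    deg x (window (q * n + a) (suc u * n ∸ ε) M) ≤ 2 * suc u
  deg-window≤-early-start q a a≤ε a<n = begin
    deg x (window (q * n + a) (suc u * n ∸ ε) M) ≤⟨ deg-window-mono x M (m≤m+n (q * n) a) inside ⟩
    deg x (window (q * n) (suc u * n) M)         ≤⟨ deg-window-blocks β len K x deg-β≤2 q (suc u) ⟩
    2 * suc u                                    ∎
    where
    open ≤-Reasoning
    a≤un : a ≤ suc u * n
    a≤un = ≤-trans (<⇒≤ a<n) (m≤m+n n (u * n))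
    inside : q * n + a + (suc u * n ∸ ε) ≤ q * n + suc u * n
    inside = begin
      q * n + a + (suc u * n ∸ ε)   ≡⟨ +-assoc (q * n) a _ ⟩
      q * n + (a + (suc u * n ∸ ε)) ≤⟨ +-monoʳ-≤ (q * n) (+-monoʳ-≤ a (∸-monoʳ-≤ (suc u * n) a≤ε)) ⟩
      q * n + (a + (suc u * n ∸ a)) ≡⟨ cong (q * n +_) (m+[n∸m]≡n a≤un) ⟩
      q * n + suc u * n             ∎

  deg-tail+head≤2 : ∀ q a → ε < a → a < n → CrossingBound q a →
    deg x (window (q * n + a) (n ∸ a) M) + deg x (window ((q + suc u) * n) (a ∸ ε) M) ≤ 2
  deg-tail+head≤2 q a ε<a a<n crossing with q + suc u <? K
  ... | yes lt = begin
    deg x (window (q * n + a) (n ∸ a) M) + deg x (window ((q + suc u) * n) (a ∸ ε) M)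
      ≡⟨ cong₂ (λ ys zs → deg x ys + deg x zs)
           (window-blocks-tail β len (≤-<-trans (m≤m+n q (suc u)) lt) (<⇒≤ a<n))
           (window-blocks-head β len lt (≤-trans (m∸n≤m a ε) (<⇒≤ a<n))) ⟩
    deg x (drop a (β q)) + deg x (take (a ∸ ε) (β (q + suc u)))
      ≤⟨ crossing lt ε<a ⟩
    2 ∎
    where open ≤-Reasoning
  ... | no ge = begin
    deg x (window (q * n + a) (n ∸ a) M) + deg x (window ((q + suc u) * n) (a ∸ ε) M)
      ≡⟨ cong (λ ys → deg x (window (q * n + a) (n ∸ a) M) + deg x ys) (window-blocks-past β len (a ∸ ε) (≮⇒≥ ge)) ⟩
    deg x (window (q * n + a) (n ∸ a) M) + 0
      ≡⟨ +-identityʳ _ ⟩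
    deg x (window (q * n + a) (n ∸ a) M)
      ≤⟨ deg-window-mono x M (m≤m+n (q * n) a) tail-inside ⟩
    deg x (window (q * n) n M)
      ≤⟨ deg-window-block β len K x deg-β≤2 q ⟩
    2 ∎
    where
    open ≤-Reasoning
    tail-inside : q * n + a + (n ∸ a) ≤ q * n + n
    tail-inside = ≤-reflexive (trans (q*n+a+[n∸a]≡[1+q]*n q n (<⇒≤ a<n)) (+-comm n (q * n)))

  deg-window≤-late-start : ∀ q a → ε < a → a < n → CrossingBound q a →
    deg x (window (q * n + a) (suc u * n ∸ ε) M) ≤ 2 * suc u
  deg-window≤-late-start q a ε<a a<n crossing = begin
    deg x (window (q * n + a) (suc u * n ∸ ε) M)
      ≡⟨ cong (λ s → deg x (window (q * n + a) s M)) ([1+u]*n∸ε≡[n∸a]+[u*n+[a∸ε]] u n (<⇒≤ ε<a) (<⇒≤ a<n)) ⟩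
    deg x (window (q * n + a) (n ∸ a + (u * n + b)) M)
      ≡⟨ deg-window-+ x (q * n + a) (n ∸ a) (u * n + b) M ⟩
    tail + deg x (window (q * n + a + (n ∸ a)) (u * n + b) M)
      ≡⟨ cong (λ i → tail + deg x (window i (u * n + b) M)) (q*n+a+[n∸a]≡[1+q]*n q n (<⇒≤ a<n)) ⟩
    tail + deg x (window (suc q * n) (u * n + b) M)
      ≡⟨ cong (tail +_) (deg-window-+ x (suc q * n) (u * n) b M) ⟩
    tail + (middle + deg x (window (suc q * n + u * n) b M))
      ≡⟨ cong (λ i → tail + (middle + deg x (window i b M))) ([1+q]*n+u*n≡[q+1+u]*n q n u) ⟩
    tail + (middle + head)
      ≡⟨ cong (tail +_) (+-comm middle head) ⟩
    tail + (head + middle)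
      ≡⟨ +-assoc tail head middle ⟨
    tail + head + middle
      ≤⟨ +-mono-≤ (deg-tail+head≤2 q a ε<a a<n crossing) (deg-window-blocks β len K x deg-β≤2 (suc q) u) ⟩
    2 + 2 * u
      ≡⟨ *-suc 2 u ⟨
    2 * suc u ∎
    where
    open ≤-Reasoning
    b = a ∸ ε
    tail = deg x (window (q * n + a) (n ∸ a) M)
    middle = deg x (window (suc q * n) (u * n) M)
    head = deg x (window ((q + suc u) * n) b M)

  deg-window≤ : ∀ q a → a < n → CrossingBound q a →
    deg x (window (q * n + a) (suc u * n ∸ ε) M) ≤ 2 * suc u
  deg-window≤ q a a<n crossing with a ≤? ε
  ... | yes a≤ε = deg-window≤-early-start q a a≤ε a<n
  ... | no a≰ε  = deg-window≤-late-start q a (≰⇒> a≰ε) a<n crossing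

  deg-every-window≤ : .{{_ : NonZero n}} → (∀ q a → a < n → CrossingBound q a) →
    ∀ p → deg x (window p (suc u * n ∸ ε) (blocks β K)) ≤ 2 * suc u
  deg-every-window≤ crossing p =
    subst (λ i → deg x (window i (suc u * n ∸ ε) (blocks β K)) ≤ 2 * suc u) (sym p≡qn+a)
      (deg-window≤ q a (m%n<n p n) (crossing q a (m%n<n p n)))
    where
    q = p / n
    a = p % n
    p≡qn+a : p ≡ q * n + a
    p≡qn+a = trans (m≡m%n+[m/n]*n p n) (+-comm a (q * n))

applyUpTo-cong : {f g : ℕ → A} → (∀ i → f i ≡ g i) → ∀ k → applyUpTo f k ≡ applyUpTo g k
applyUpTo-cong f≗g zero    = refl
applyUpTo-cong f≗g (suc k) = cong₂ _∷_ (f≗g 0) (applyUpTo-cong (λ i → f≗g (suc i)) k)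

applyUpTo-+ : (f : ℕ → A) (m k : ℕ) → applyUpTo f (m + k) ≡ applyUpTo f m ++ applyUpTo (λ i → f (m + i)) k
applyUpTo-+ f zero    k = refl
applyUpTo-+ f (suc m) k = cong (f 0 ∷_) (applyUpTo-+ (λ i → f (suc i)) m k)

tabulate≡applyUpTo : ∀ {k} (h : Fin k → A) (f : ℕ → A) → (∀ i → h i ≡ f (toℕ i)) →
  tabulate h ≡ applyUpTo f k
tabulate≡applyUpTo {k = zero}  h f h≗f = refl
tabulate≡applyUpTo {k = suc k} h f h≗f =
  cong₂ _∷_ (h≗f Fin.zero)
    (tabulate≡applyUpTo (λ i → h (Fin.suc i)) (λ i → f (suc i)) (λ i → h≗f (Fin.suc i)))

mod-cong : ∀ m m' {k} .{{_ : NonZero k}} → m % k ≡ m' % k → m mod k ≡ m' mod k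
mod-cong m m' eq = toℕ-injective (trans (toℕ-fromℕ< _) (trans eq (sym (toℕ-fromℕ< _))))

module _ {t : ℕ} (ℓ : Fin (suc t) → List A) where

  periodic : ℕ → List A
  periodic m = ℓ (m mod suc t)

  concat-allFin≡blocks : concat (map ℓ (allFin (suc t))) ≡ blocks periodic (suc t)
  concat-allFin≡blocks =
    cong concat (trans (map-tabulate (λ i → i) ℓ) (tabulate≡applyUpTo ℓ periodic ℓ≗periodic))
    where
    ℓ≗periodic : ∀ i → ℓ i ≡ periodic (toℕ i)
    ℓ≗periodic i = cong ℓ (toℕ-injective (sym (trans (toℕ-fromℕ< _) (m<n⇒m%n≡m (toℕ<n i)))))

  periodic-+ : ∀ i → periodic (suc t + i) ≡ periodic i
  periodic-+ i = cong ℓ (mod-cong (suc t + i) i (begin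
    (suc t + i) % suc t ≡⟨ cong (_% suc t) (+-comm (suc t) i) ⟩
    (i + suc t) % suc t ≡⟨ [m+n]%n≡m%n i (suc t) ⟩
    i % suc t           ∎))
    where open ≡-Reasoning

  concat-allFin-twice≡blocks :
    concat (map ℓ (allFin (suc t))) ++ concat (map ℓ (allFin (suc t))) ≡ blocks periodic (suc t + suc t)
  concat-allFin-twice≡blocks = begin
    L ++ L
      ≡⟨ cong₂ _++_ concat-allFin≡blocks concat-allFin≡blocks ⟩
    blocks periodic (suc t) ++ blocks periodic (suc t)
      ≡⟨ cong (λ xss → blocks periodic (suc t) ++ concat xss) (applyUpTo-cong periodic-+ (suc t)) ⟨
    blocks periodic (suc t) ++ blocks (λ i → periodic (suc t + i)) (suc t)
      ≡⟨ concat-++ (applyUpTo periodic (suc t)) _ ⟩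
    concat (applyUpTo periodic (suc t) ++ applyUpTo (λ i → periodic (suc t + i)) (suc t))
      ≡⟨ cong concat (applyUpTo-+ periodic (suc t) (suc t)) ⟨
    blocks periodic (suc t + suc t) ∎
    where
    open ≡-Reasoning
    L = concat (map ℓ (allFin (suc t)))

  mod-⊕ : ∀ q u → (q mod suc t) ⊕ u ≡ (q + u) mod suc t
  mod-⊕ q u = mod-cong (toℕ (q mod suc t) + u) (q + u) (begin
    (toℕ (q mod suc t) + u) % suc t       ≡⟨ cong (λ k → (k + u) % suc t) (toℕ-fromℕ< (m%n<n q (suc t))) ⟩
    (q % suc t + u) % suc t               ≡⟨ %-distribˡ-+ (q % suc t) u (suc t) ⟩
    (q % suc t % suc t + u % suc t) % suc t ≡⟨ cong (λ k → (k + u % suc t) % suc t) (m%n%n≡m%n q (suc t)) ⟩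
    (q % suc t + u % suc t) % suc t       ≡⟨ %-distribˡ-+ q u (suc t) ⟨
    (q + u) % suc t                       ∎)
    where open ≡-Reasoning

2u<Δ⇒u<t : ∀ {t u} {E : List (Edge v)} (ℓ : Fin t → List (Edge v)) → 2 * u < maxDeg E →
  E ↭ concat (map ℓ (allFin t)) → (∀ i → Regular 2 (ℓ i)) → u < t
2u<Δ⇒u<t {t = t} {u} {E} ℓ 2u<Δ E↭ regular = *-cancelˡ-< 2 u t (<-≤-trans 2u<Δ Δ≤2t)
  where
  Δ≤2t : maxDeg E ≤ 2 * t
  Δ≤2t = subst (λ k → maxDeg E ≤ 2 * k) (trans (length-map ℓ (allFin t)) (length-tabulate {n = t} (λ i → i)))
           (maxDeg-concat≤ E (map ℓ (allFin t)) E↭ (All-map⁺ (tabulate⁺ regular)))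

module _ {t n : ℕ} (ℓ : Fin (suc t) → List (Edge v))
         (regular : ∀ i → Regular 2 (ℓ i)) (len : ∀ i → length (ℓ i) ≡ n) (u ε : ℕ) where

  private
    L = concat (map ℓ (allFin (suc t)))
    s = suc u * n ∸ ε

    len-periodic : BlockLengths n (periodic ℓ)
    len-periodic m = len (m mod suc t)

    PairBound : Fin (suc t) → Set
    PairBound i = MsPairAtLeast 2 (ℓ i) (ℓ (i ⊕ suc u)) (n ∸ ε)

    crossing-from-pair : (x : Fin v) {K : ℕ} → ∀ q a → a < n → PairBound (q mod suc t) →
      CrossingBound (periodic ℓ) len-periodic {K} x (λ j → regular _ x) u ε q a
    crossing-from-pair x q a a<n pair _ ε<a =
      deg-crossing≤ x (periodic ℓ q) (periodic ℓ (q + suc u)) (len-periodic q) (len-periodic (q + suc u))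
        (subst (λ C' → MsPairAtLeast 2 (periodic ℓ q) C' (n ∸ ε)) (cong ℓ (mod-⊕ ℓ q (suc u))) pair) ε<a a<n

  length-concat-allFin : length L ≡ suc t * n
  length-concat-allFin = trans (cong length (concat-allFin≡blocks ℓ)) (length-blocks (periodic ℓ) len-periodic (suc t))

  consecutive-windows : .{{_ : NonZero n}} → (∀ i → toℕ i < suc t ∸ suc u → PairBound i) →
    ConsecGood (2 * suc u) L s
  consecutive-windows pairs p _ x =
    subst (λ M → deg x (window p s M) ≤ 2 * suc u) (sym (concat-allFin≡blocks ℓ))
      (deg-every-window≤ (periodic ℓ) len-periodic {suc t} x (λ j → regular _ x) u ε crossing p)
    where
    crossing : ∀ q a → a < n → CrossingBound (periodic ℓ) len-periodic {suc t} x (λ j → regular _ x) u ε q a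
    crossing q a a<n lt = crossing-from-pair x q a a<n (pairs (q mod suc t) index-bound) lt
      where
      index-bound : toℕ (q mod suc t) < suc t ∸ suc u
      index-bound = subst (_< suc t ∸ suc u)
        (sym (trans (toℕ-fromℕ< _) (m<n⇒m%n≡m (≤-<-trans (m≤m+n q (suc u)) lt))))
        (m+n≤o⇒m≤o∸n (suc q) lt)

  cyclic-windows : .{{_ : NonZero n}} → (∀ i → PairBound i) → CycConsecGood (2 * suc u) L s
  cyclic-windows pairs p _ x =
    subst (λ M → deg x (window p s M) ≤ 2 * suc u) (sym (concat-allFin-twice≡blocks ℓ))
      (deg-every-window≤ (periodic ℓ) len-periodic {suc t + suc t} x (λ j → regular _ x) u ε
        (λ q a a<n → crossing-from-pair x q a a<n (pairs (q mod suc t))) p)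

proposition10 : (v t n r u ε : ℕ) (E : List (Edge v)) (ℓ : Fin t → List (Edge v)) →
    SimpleGraph E → 0 < r → r ≡ 2 * u → r < maxDeg E →
    E ↭ concat (map ℓ (allFin t)) →
    ((i : Fin t) → Regular 2 (ℓ i)) → ((i : Fin t) → length (ℓ i) ≡ n) →
    0 < ε → ε < ⌈ n /2⌉ →
    (((i : Fin t) → toℕ i < t ∸ u → MsPairAtLeast 2 (ℓ i) (ℓ (i ⊕ u)) (n ∸ ε)) →
        MsAtLeast r E (u * n ∸ ε))
    × (((i : Fin t) → MsPairAtLeast 2 (ℓ i) (ℓ (i ⊕ u)) (n ∸ ε)) →
        CmsAtLeast r E (u * n ∸ ε))
proposition10 v t zero r u ε E ℓ _ _ _ _ _ _ _ _ ()
proposition10 v t (suc n) r zero ε E ℓ _ () refl _ _ _ _ _ _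
proposition10 v t (suc n) r (suc u) ε E ℓ _ _ refl 2u<Δ E↭ regular len _ _
  with 2u<Δ⇒u<t {u = suc u} ℓ 2u<Δ E↭ regular
proposition10 v (suc t) (suc n) _ (suc u) ε E ℓ _ _ refl 2u<Δ E↭ regular len _ _ | u<t@(s≤s _) =
    (λ pairs → L , ↭-sym E↭ , s , ≤-refl , s≤|E| , consecutive-windows ℓ regular len u ε pairs)
  , (λ pairs → L , ↭-sym E↭ , s , ≤-refl , s≤|E| , cyclic-windows ℓ regular len u ε pairs)
  where
  L = concat (map ℓ (allFin (suc t)))
  s = suc u * suc n ∸ ε
  s≤|E| : s ≤ length E
  s≤|E| = begin
    s                 ≤⟨ m∸n≤m (suc u * suc n) ε ⟩
    suc u * suc n     ≤⟨ *-monoˡ-≤ (suc n) (<⇒≤ u<t) ⟩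
    suc t * suc n     ≡⟨ trans (↭-length E↭) (length-concat-allFin ℓ regular len u ε) ⟨
    length E          ∎
    where open ≤-Reasoning
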